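{- Let $k\geqslant 2$ be an integer. Then $$\limsup_{n\to\infty}\frac{R_k(n)}{n}=\frac{k}{k+1}.$$
   Context: A set $A\subset \mathbb{Z}/n\mathbb{Z}$ is called $k$-free if for all $x\in A$, $kx\notin A$. $R_k(n)$ denotes the maximal cardinality of a $k$-free subset of $\mathbb{Z}/n\mathbb{Z}$. -}

module Defs where

open import Data.Nat using (ℕ; zero; suc; _*_; _⊔_) renaming (_≤_ to _≤ℕ_)
open import Data.Nat.DivMod using (_mod_)
open import Data.Fin using (Fin; toℕ)
open import Data.Fin.Subset using (Subset; _∈_; _∉_; ∣_∣)
open import Data.Fin.Subset.Properties using (_∈?_)
open import Data.Fin.Properties using (all?)
open import Data.Bool using (true; false)
open import Data.Vec using ([]; _∷_)
open import Data.List using (List; []; _∷_; map; _++_; filter; foldr)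
open import Data.Integer using (+_)
open import Data.Rational using (ℚ; 0ℚ; _/_; _+_; _-_; _≤_; Positive)
open import Data.Product using (∃-syntax; _×_)
open import Relation.Nullary using (Dec; ¬_; ¬?)
open import Relation.Nullary.Decidable using (_→-dec_)

-- multiplication by k in ℤ/nℤ, with ℤ/nℤ represented as Fin n
-- (residues 0 … n-1)
mulZn : ℕ → {n : ℕ} → Fin n → Fin n
mulZn k {suc m} x = (k * toℕ x) mod (suc m)

KFree : ℕ → {n : ℕ} → Subset n → Set
KFree k {n} A = ∀ (x : Fin n) → x ∈ A → mulZn k x ∉ A

kFree? : (k : ℕ) → {n : ℕ} → (A : Subset n) → Dec (KFree k A)
kFree? k A = all? (λ x → (x ∈? A) →-dec ¬? (mulZn k x ∈? A))

allSubsets : (n : ℕ) → List (Subset n)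
allSubsets zero = [] ∷ []
allSubsets (suc n) = map (true ∷_) (allSubsets n) ++ map (false ∷_) (allSubsets n)

R : ℕ → ℕ → ℕ
R k n = foldr (λ A m → ∣ A ∣ ⊔ m) 0 (filter (kFree? k) (allSubsets n))

-- the sequence R_k(n)/n (the value at n = 0 is irrelevant; set to 0)
ratio : ℕ → ℕ → ℚ
ratio k zero = 0ℚ
ratio k (suc m) = (+ R k (suc m)) / suc m

-- limsup_{n→∞} a n = L, for a rational sequence and rational L,
-- by its ε-characterisation:
--  (i)  for every ε > 0, eventually a n ≤ L + ε   (limsup ≤ L)
--  (ii) for every ε > 0, a n ≥ L - ε for infinitely many n (limsup ≥ L)
LimsupEq : (ℕ → ℚ) → ℚ → Set
LimsupEq a L =
  (∀ (ε : ℚ) → Positive ε → ∃[ N ] (∀ n → N ≤ℕ n → a n ≤ L + ε))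
  × (∀ (ε : ℚ) → Positive ε → ∀ (N : ℕ) → ∃[ n ] (N ≤ℕ n × L - ε ≤ a n))

-- Upper bound: x ↦ kx embeds a k-free A ⊆ ℤ/nℤ into the integers z < kn with
-- z mod n ∉ A, and every residue mod n is hit by exactly k of them; hence
-- |A| ≤ k (n − |A|) and R_k(n)/n ≤ k/(k+1) for every n.
-- Lower bound: in ℤ/k^mℤ the nonzero residues of even k-adic valuation form a
-- k-free set, since multiplication by k raises the valuation by one. Counting
-- them digit by digit gives (k+1)|A| + k ≥ k^(m+1), so R_k(k^m)/k^m → k/(k+1).
module Submission where

open import Defs
open import Data.Bool using (Bool; true; false; not; if_then_else_)
open import Data.Empty using (⊥)
open import Data.Fin using (Fin; toℕ) renaming (zero to fzero; suc to fsuc)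
open import Data.Fin.Properties using (toℕ-fromℕ<; toℕ-injective; toℕ<n)
open import Data.Fin.Subset using (Subset; _∈_; ∣_∣)
open import Data.Integer as ℤ using (+_; +[1+_]; +≤+)
import Data.Integer.Properties as ℤ
open import Data.List using (List; []; _∷_; filter; foldr)
open import Data.List.Membership.Propositional using () renaming (_∈_ to _∈ₗ_)
open import Data.List.Membership.Propositional.Properties
  using (∈-map⁺; ∈-++⁺ˡ; ∈-++⁺ʳ; ∈-filter⁺; ∈-filter⁻)
open import Data.List.Relation.Unary.Any using (here; there)
open import Data.Nat hiding (_/_)
import Data.Nat as ℕ using (_/_)
open import Data.Nat.DivMod hiding (_/_)
open import Data.Nat.Divisibility using (divides; n∣m*n)
open import Data.Nat.Properties
open import Algebra.Properties.Semiring.Sum +-*-semiring using (sum; sum-syntax; sum-cong-≗; ∑-distrib-+)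
open import Data.Nat.Tactic.RingSolver using (solve-∀)
open import Data.Product using (_×_; _,_; proj₂; ∃-syntax)
import Data.Rational as ℚ
open import Data.Rational using (mkℚ; toℚᵘ; _/_)
import Data.Rational.Properties as ℚ
open import Data.Rational.Unnormalised as ℚᵘ using (mkℚᵘ; *≤*)
import Data.Rational.Unnormalised.Properties as ℚᵘ
open import Data.Vec using (lookup; tabulate; []; _∷_)
open import Data.Vec.Properties using ([]=⇒lookup; lookup⇒[]=; lookup∘tabulate)
open import Function using (_∘_)
open import Relation.Binary.PropositionalEquality
open import Relation.Nullary using (contradiction)

indicator : Bool → ℕ
indicator true  = 1
indicator false = 0

∑-mono-≤ : ∀ {n} {f g : Fin n → ℕ} → (∀ i → f i ≤ g i) → sum f ≤ sum g
∑-mono-≤ {zero}  f≤g = z≤n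
∑-mono-≤ {suc n} f≤g = +-mono-≤ (f≤g fzero) (∑-mono-≤ (f≤g ∘ fsuc))

∑-const : ∀ n c → ∑[ i < n ] c ≡ n * c
∑-const zero    c = refl
∑-const (suc n) c = cong (_+_ c) (∑-const n c)

∑-+-split : ∀ m n (g : ℕ → ℕ) →
            ∑[ i < m + n ] g (toℕ i) ≡ ∑[ i < m ] g (toℕ i) + ∑[ i < n ] g (m + toℕ i)
∑-+-split zero    n g = refl
∑-+-split (suc m) n g =
  trans (cong (_+_ (g 0)) (∑-+-split m n (g ∘ suc))) (sym (+-assoc (g 0) _ _))

∑-blocks : ∀ c n (g : ℕ → ℕ) →
           ∑[ i < c * n ] g (toℕ i) ≡ ∑[ q < c ] ∑[ r < n ] g (toℕ q * n + toℕ r)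
∑-blocks zero    n g = refl
∑-blocks (suc c) n g = begin
  ∑[ i < n + c * n ] g (toℕ i)
    ≡⟨ ∑-+-split n (c * n) g ⟩
  ∑[ r < n ] g (toℕ r) + ∑[ i < c * n ] g (n + toℕ i)
    ≡⟨ cong (_+_ (∑[ r < n ] g (toℕ r))) (∑-blocks c n (g ∘ _+_ n)) ⟩
  ∑[ r < n ] g (toℕ r) + ∑[ q < c ] ∑[ r < n ] g (n + (toℕ q * n + toℕ r))
    ≡⟨ cong (_+_ (∑[ r < n ] g (toℕ r)))
         (sum-cong-≗ {c} λ q → sum-cong-≗ {n} λ r →
            cong g (sym (+-assoc n (toℕ q * n) (toℕ r)))) ⟩
  ∑[ q < suc c ] ∑[ r < n ] g (toℕ q * n + toℕ r) ∎
  where open ≡-Reasoning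

∣p∣≡∑ : ∀ {n} (p : Subset n) → ∣ p ∣ ≡ ∑[ x < n ] indicator (lookup p x)
∣p∣≡∑ []          = refl
∣p∣≡∑ (true ∷ p)  = cong suc (∣p∣≡∑ p)
∣p∣≡∑ (false ∷ p) = ∣p∣≡∑ p

∣p∣+∣∁p∣≡n : ∀ {n} (p : Subset n) →
             ∣ p ∣ + ∑[ x < n ] indicator (not (lookup p x)) ≡ n
∣p∣+∣∁p∣≡n []          = refl
∣p∣+∣∁p∣≡n (true ∷ p)  = cong suc (∣p∣+∣∁p∣≡n p)
∣p∣+∣∁p∣≡n (false ∷ p) = trans (+-suc ∣ p ∣ _) (cong suc (∣p∣+∣∁p∣≡n p))

[q*n+r]%n≡r : ∀ q {n r} .{{_ : NonZero n}} → r < n → (q * n + r) % n ≡ r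
[q*n+r]%n≡r q {n} {r} r<n = begin
  (q * n + r) % n ≡⟨ %-congˡ (+-comm (q * n) r) ⟩
  (r + q * n) % n ≡⟨ [m+kn]%n≡m%n r q n ⟩
  r % n           ≡⟨ m<n⇒m%n≡m r<n ⟩
  r               ∎
  where open ≡-Reasoning

[q*n+r]/n≡q : ∀ q {n r} .{{_ : NonZero n}} → r < n → (q * n + r) ℕ./ n ≡ q
[q*n+r]/n≡q q {n} {r} r<n = begin
  (q * n + r) ℕ./ n     ≡⟨ +-distrib-/-∣ˡ r (n∣m*n q) ⟩
  q * n ℕ./ n + r ℕ./ n ≡⟨ cong₂ _+_ (m*n/n≡m q n) (m<n⇒m/n≡0 r<n) ⟩
  q + 0                 ≡⟨ +-identityʳ q ⟩
  q                     ∎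
  where open ≡-Reasoning

[q*n+r]mod-n≡r : ∀ q {n} .{{_ : NonZero n}} (r : Fin n) → (q * n + toℕ r) mod n ≡ r
[q*n+r]mod-n≡r q r = toℕ-injective (trans (toℕ-fromℕ< _) ([q*n+r]%n≡r q (toℕ<n r)))

mulZn≡mod : ∀ k {n} .{{_ : NonZero n}} (x : Fin n) → mulZn k x ≡ (k * toℕ x) mod n
mulZn≡mod k {suc n} x = refl

kFree-indicator-≤ : ∀ {k n} {A : Subset n} → KFree k A →
                    ∀ x → indicator (lookup A x) ≤ indicator (not (lookup A (mulZn k x)))
kFree-indicator-≤ {k} {A = A} kfree x with lookup A x in x∈A | lookup A (mulZn k x) in kx∈A
... | false | _     = z≤n
... | true  | false = ≤-refl
... | true  | true  =
  contradiction (lookup⇒[]= (mulZn k x) A kx∈A) (kfree x (lookup⇒[]= x A x∈A))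

kFree-card-bound : ∀ {k n} (A : Subset n) → 1 ≤ k → KFree k A → suc k * ∣ A ∣ ≤ k * n
kFree-card-bound {k} {zero} [] _ _ = ≤-reflexive (trans (*-zeroʳ (suc k)) (sym (*-zeroʳ k)))
kFree-card-bound {k@(suc k-1)} {n@(suc _)} A _ kfree = begin
  ∣ A ∣ + k * ∣ A ∣    ≤⟨ +-monoˡ-≤ (k * ∣ A ∣) ∣A∣≤k*∣∁A∣ ⟩
  k * ∣∁A∣ + k * ∣ A ∣ ≡⟨ *-distribˡ-+ k ∣∁A∣ ∣ A ∣ ⟨
  k * (∣∁A∣ + ∣ A ∣)   ≡⟨ cong (k *_) (+-comm ∣∁A∣ ∣ A ∣) ⟩
  k * (∣ A ∣ + ∣∁A∣)   ≡⟨ cong (k *_) (∣p∣+∣∁p∣≡n A) ⟩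
  k * n                ∎
  where
  open ≤-Reasoning
  outside : ℕ → ℕ
  outside z = indicator (not (lookup A (z mod n)))
  ∣∁A∣ : ℕ
  ∣∁A∣ = ∑[ y < n ] indicator (not (lookup A y))
  k*x-outside : ∀ x → indicator (lookup A x) ≤ outside (toℕ x * k + 0)
  k*x-outside x rewrite +-identityʳ (toℕ x * k) | *-comm (toℕ x) k =
    subst (λ y → indicator (lookup A x) ≤ indicator (not (lookup A y)))
          (mulZn≡mod k x) (kFree-indicator-≤ {k} kfree x)
  ∣A∣≤k*∣∁A∣ : ∣ A ∣ ≤ k * ∣∁A∣
  ∣A∣≤k*∣∁A∣ = begin
    ∣ A ∣                                             ≡⟨ ∣p∣≡∑ A ⟩
    ∑[ x < n ] indicator (lookup A x)                 ≤⟨ ∑-mono-≤ {n} k*x-outside ⟩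
    ∑[ x < n ] outside (toℕ x * k + 0)
      ≤⟨ ∑-mono-≤ {n} (λ x → m≤m+n (outside (toℕ x * k + 0))
                                   (∑[ r < k-1 ] outside (toℕ x * k + suc (toℕ r)))) ⟩
    ∑[ x < n ] ∑[ r < k ] outside (toℕ x * k + toℕ r) ≡⟨ ∑-blocks n k outside ⟨
    ∑[ z < n * k ] outside (toℕ z)
      ≡⟨ cong (λ m → ∑[ z < m ] outside (toℕ z)) (*-comm n k) ⟩
    ∑[ z < k * n ] outside (toℕ z)                    ≡⟨ ∑-blocks k n outside ⟩
    ∑[ q < k ] ∑[ r < n ] outside (toℕ q * n + toℕ r)
      ≡⟨ sum-cong-≗ {k} (λ q → sum-cong-≗ {n} λ r →
           cong (indicator ∘ not ∘ lookup A) ([q*n+r]mod-n≡r (toℕ q) r)) ⟩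
    ∑[ q < k ] ∣∁A∣                                   ≡⟨ ∑-const k ∣∁A∣ ⟩
    k * ∣∁A∣                                          ∎

∈-allSubsets : ∀ {n} (A : Subset n) → A ∈ₗ allSubsets n
∈-allSubsets []          = here refl
∈-allSubsets (true ∷ A)  = ∈-++⁺ˡ (∈-map⁺ (true ∷_) (∈-allSubsets A))
∈-allSubsets (false ∷ A) = ∈-++⁺ʳ _ (∈-map⁺ (false ∷_) (∈-allSubsets A))

module _ {n : ℕ} where

  maxCard : List (Subset n) → ℕ
  maxCard = foldr (λ A m → ∣ A ∣ ⊔ m) 0

  ∣A∣≤maxCard : ∀ {A L} → A ∈ₗ L → ∣ A ∣ ≤ maxCard L
  ∣A∣≤maxCard (here refl) = m≤m⊔n _ _
  ∣A∣≤maxCard {L = B ∷ L} (there A∈L) = ≤-trans (∣A∣≤maxCard A∈L) (m≤n⊔m ∣ B ∣ _)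

  *-maxCard-≤ : ∀ c b L → (∀ {A} → A ∈ₗ L → c * ∣ A ∣ ≤ b) → c * maxCard L ≤ b
  *-maxCard-≤ c b []      _     = ≤-trans (≤-reflexive (*-zeroʳ c)) z≤n
  *-maxCard-≤ c b (A ∷ L) bound = begin
    c * (∣ A ∣ ⊔ maxCard L)   ≡⟨ *-distribˡ-⊔ c ∣ A ∣ (maxCard L) ⟩
    c * ∣ A ∣ ⊔ c * maxCard L
      ≤⟨ ⊔-lub (bound (here refl)) (*-maxCard-≤ c b L (bound ∘ there)) ⟩
    b                         ∎
    where open ≤-Reasoning

kFree⇒∣A∣≤R : ∀ k {n} (A : Subset n) → KFree k A → ∣ A ∣ ≤ R k n
kFree⇒∣A∣≤R k A kfree = ∣A∣≤maxCard (∈-filter⁺ (kFree? k) (∈-allSubsets A) kfree)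

R-upper-bound : ∀ k n → 1 ≤ k → suc k * R k n ≤ k * n
R-upper-bound k n 1≤k = *-maxCard-≤ (suc k) (k * n) (filter (kFree? k) (allSubsets n))
  λ A∈ → kFree-card-bound _ 1≤k (proj₂ (∈-filter⁻ (kFree? k) {xs = allSubsets n} A∈))

module KAdicParity (j : ℕ) where

  k : ℕ
  k = suc j

  -- evenVal m x (oddVal m x): x ≢ 0 mod k^m and the k-adic valuation of x is even (odd).
  evenVal oddVal : ℕ → ℕ → Bool
  evenVal zero    x = false
  evenVal (suc m) x = if x % k ≡ᵇ 0 then oddVal m (x ℕ./ k) else true
  oddVal  zero    x = false
  oddVal  (suc m) x = if x % k ≡ᵇ 0 then evenVal m (x ℕ./ k) else false

  evenVal-digit : ∀ m q {r} → r < k →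
                  evenVal (suc m) (q * k + r) ≡ (if r ≡ᵇ 0 then oddVal m q else true)
  evenVal-digit m q r<k rewrite [q*n+r]%n≡r q r<k | [q*n+r]/n≡q q r<k = refl

  oddVal-digit : ∀ m q {r} → r < k →
                 oddVal (suc m) (q * k + r) ≡ (if r ≡ᵇ 0 then evenVal m q else false)
  oddVal-digit m q r<k rewrite [q*n+r]%n≡r q r<k | [q*n+r]/n≡q q r<k = refl

  evenVal-k* : ∀ m y → evenVal (suc m) (k * y) ≡ oddVal m y
  evenVal-k* m y =
    trans (cong (evenVal (suc m)) (trans (*-comm k y) (sym (+-identityʳ (y * k)))))
          (evenVal-digit m y z<s)

  even-odd-disjoint : ∀ m m' x → evenVal m x ≡ true → oddVal m' x ≡ true → ⊥
  even-odd-disjoint (suc m) (suc m') x e o with x % k ≡ᵇ 0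
  ... | true  = even-odd-disjoint m' m (x ℕ./ k) o e
  even-odd-disjoint (suc m) (suc m') x e () | false
  even-odd-disjoint (suc m) zero     x e ()

  _%k^_ : ℕ → ℕ → ℕ
  x %k^ m = _%_ x (k ^ m) {{m^n≢0 k m}}

  k^suc≡k^*k : ∀ m → k ^ suc m ≡ k ^ m * k
  k^suc≡k^*k m = *-comm k (k ^ m)

  %k^suc-%k : ∀ m x → (x %k^ suc m) % k ≡ x % k
  %k^suc-%k m x =
    m∣n⇒o%n%m≡o%m k (k ^ suc m) x {{_}} {{m^n≢0 k (suc m)}} (divides (k ^ m) (k^suc≡k^*k m))

  %k^suc-/k : ∀ m x → (x %k^ suc m) ℕ./ k ≡ (x ℕ./ k) %k^ m
  %k^suc-/k m x = begin
    (x %k^ suc m) ℕ./ k     ≡⟨ /-congˡ (%-congʳ (k^suc≡k^*k m)) ⟩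
    (x % (k ^ m * k)) ℕ./ k ≡⟨ m%[n*o]/o≡m/o%n x (k ^ m) k ⟩
    (x ℕ./ k) %k^ m         ∎
    where
    open ≡-Reasoning
    instance
      _ = m^n≢0 k m
      _ = m^n≢0 k (suc m)
      _ = m*n≢0 (k ^ m) k

  evenVal-%k^ : ∀ m x → evenVal m (x %k^ m) ≡ evenVal m x
  oddVal-%k^  : ∀ m x → oddVal m (x %k^ m) ≡ oddVal m x
  evenVal-%k^ zero    x = refl
  evenVal-%k^ (suc m) x rewrite %k^suc-%k m x | %k^suc-/k m x | oddVal-%k^ m (x ℕ./ k) = refl
  oddVal-%k^  zero    x = refl
  oddVal-%k^  (suc m) x rewrite %k^suc-%k m x | %k^suc-/k m x | evenVal-%k^ m (x ℕ./ k) = refl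

  k*-%k^suc : ∀ m x → (k * x) %k^ suc m ≡ k * (x %k^ m)
  k*-%k^suc m x = sym (begin
    k * (x %k^ m)         ≡⟨ *-comm k (x %k^ m) ⟩
    (x %k^ m) * k         ≡⟨ m%n*o≡m*o%[n*o] x (k ^ m) k ⟩
    (x * k) % (k ^ m * k) ≡⟨ %-congˡ (*-comm x k) ⟩
    (k * x) % (k ^ m * k) ≡⟨ %-congʳ (sym (k^suc≡k^*k m)) ⟩
    (k * x) %k^ suc m     ∎)
    where
    open ≡-Reasoning
    instance
      _ = m^n≢0 k m
      _ = m^n≢0 k (suc m)
      _ = m*n≢0 (k ^ m) k

  evenVal-k*-%k^ : ∀ m x → evenVal m x ≡ true → evenVal m ((k * x) %k^ m) ≡ true → ⊥
  evenVal-k*-%k^ zero    x () _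
  evenVal-k*-%k^ (suc m) x e e'
    rewrite k*-%k^suc m x | evenVal-k* m (x %k^ m) | oddVal-%k^ m x =
      even-odd-disjoint (suc m) m x e e'

  evenValSet : ∀ m → Subset (k ^ m)
  evenValSet m = tabulate (evenVal m ∘ toℕ)

  evenValSet-kFree : ∀ m → KFree k (evenValSet m)
  evenValSet-kFree m x x∈A kx∈A = evenVal-k*-%k^ m (toℕ x) (member x x∈A)
    (trans (cong (evenVal m) (sym toℕ-kx)) (member (mulZn k x) kx∈A))
    where
    instance _ = m^n≢0 k m
    member : ∀ y → y ∈ evenValSet m → evenVal m (toℕ y) ≡ true
    member y y∈A = trans (sym (lookup∘tabulate (evenVal m ∘ toℕ) y)) ([]=⇒lookup y∈A)
    toℕ-kx : toℕ (mulZn k x) ≡ (k * toℕ x) %k^ m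
    toℕ-kx = trans (cong toℕ (mulZn≡mod k x)) (toℕ-fromℕ< _)

  #evenVal #oddVal : ℕ → ℕ
  #evenVal m = ∑[ x < k ^ m ] indicator (evenVal m (toℕ x))
  #oddVal  m = ∑[ x < k ^ m ] indicator (oddVal m (toℕ x))

  ∑-by-last-digit : ∀ m (f g : ℕ → Bool) c →
    (∀ q {r} → r < k → f (q * k + r) ≡ (if r ≡ᵇ 0 then g q else c)) →
    ∑[ x < k ^ suc m ] indicator (f (toℕ x)) ≡
    ∑[ q < k ^ m ] indicator (g (toℕ q)) + k ^ m * (j * indicator c)
  ∑-by-last-digit m f g c f-digit = begin
    ∑[ x < k ^ suc m ] indicator (f (toℕ x))
      ≡⟨ cong (λ n → ∑[ x < n ] indicator (f (toℕ x))) (k^suc≡k^*k m) ⟩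
    ∑[ x < k ^ m * k ] indicator (f (toℕ x))
      ≡⟨ ∑-blocks (k ^ m) k (indicator ∘ f) ⟩
    ∑[ q < k ^ m ] ∑[ r < k ] indicator (f (toℕ q * k + toℕ r))
      ≡⟨ sum-cong-≗ {k ^ m} (λ q → sum-cong-≗ {k} λ r →
           cong indicator (f-digit (toℕ q) (toℕ<n r))) ⟩
    ∑[ q < k ^ m ] (indicator (g (toℕ q)) + ∑[ r < j ] indicator c)
      ≡⟨ ∑-distrib-+ {k ^ m} (indicator ∘ g ∘ toℕ) (λ _ → ∑[ r < j ] indicator c) ⟩
    ∑[ q < k ^ m ] indicator (g (toℕ q)) + ∑[ q < k ^ m ] ∑[ r < j ] indicator c
      ≡⟨ cong (_+_ (∑[ q < k ^ m ] indicator (g (toℕ q))))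
              (trans (∑-const (k ^ m) _) (cong (k ^ m *_) (∑-const j (indicator c)))) ⟩
    ∑[ q < k ^ m ] indicator (g (toℕ q)) + k ^ m * (j * indicator c) ∎
    where open ≡-Reasoning

  #evenVal-suc : ∀ m → #evenVal (suc m) ≡ #oddVal m + k ^ m * j
  #evenVal-suc m = trans (∑-by-last-digit m (evenVal (suc m)) (oddVal m) true (evenVal-digit m))
                         (cong (λ t → #oddVal m + k ^ m * t) (*-identityʳ j))

  #oddVal-suc : ∀ m → #oddVal (suc m) ≡ #evenVal m
  #oddVal-suc m = begin
    #oddVal (suc m)
      ≡⟨ ∑-by-last-digit m (oddVal (suc m)) (evenVal m) false (oddVal-digit m) ⟩
    #evenVal m + k ^ m * (j * 0) ≡⟨ cong (λ t → #evenVal m + k ^ m * t) (*-zeroʳ j) ⟩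
    #evenVal m + k ^ m * 0       ≡⟨ cong (_+_ (#evenVal m)) (*-zeroʳ (k ^ m)) ⟩
    #evenVal m + 0               ≡⟨ +-identityʳ (#evenVal m) ⟩
    #evenVal m                   ∎
    where open ≡-Reasoning

  #evenVal-lower : ∀ m → k * k ^ m ≤ suc k * #evenVal m + k
  #evenVal-lower zero = ≤-reflexive (trans (*-identityʳ k) (cong (_+ k) (sym (*-zeroʳ (suc k)))))
  #evenVal-lower (suc zero) rewrite #evenVal-suc 0 =
    ≤-trans (m≤m+n (k * (k * 1)) j) (≤-reflexive (sym (one-digit j)))
    where
    one-digit : ∀ j → (2 + j) * (0 + 1 * j) + (1 + j) ≡ (1 + j) * ((1 + j) * 1) + j
    one-digit = solve-∀
  #evenVal-lower (suc (suc m)) = begin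
    k * k ^ (2 + m)                                   ≡⟨ expand j (k ^ m) ⟩
    k * k ^ m + suc k * (k ^ suc m * j)               ≤⟨ +-monoˡ-≤ _ (#evenVal-lower m) ⟩
    suc k * #evenVal m + k + suc k * (k ^ suc m * j)  ≡⟨ regroup j (#evenVal m) (k ^ suc m) ⟩
    suc k * (#evenVal m + k ^ suc m * j) + k
      ≡⟨ cong (λ t → suc k * (t + k ^ suc m * j) + k) (sym (#oddVal-suc m)) ⟩
    suc k * (#oddVal (suc m) + k ^ suc m * j) + k
      ≡⟨ cong (λ t → suc k * t + k) (sym (#evenVal-suc (suc m))) ⟩
    suc k * #evenVal (2 + m) + k                      ∎
    where
    open ≤-Reasoning
    expand : ∀ j K → (1 + j) * ((1 + j) * ((1 + j) * K)) ≡ (1 + j) * K + (2 + j) * ((1 + j) * K * j)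
    expand = solve-∀
    regroup : ∀ j E K → (2 + j) * E + (1 + j) + (2 + j) * (K * j) ≡ (2 + j) * (E + K * j) + (1 + j)
    regroup = solve-∀

  ∣evenValSet∣≡#evenVal : ∀ m → ∣ evenValSet m ∣ ≡ #evenVal m
  ∣evenValSet∣≡#evenVal m =
    trans (∣p∣≡∑ (evenValSet m))
          (sum-cong-≗ {k ^ m} (cong indicator ∘ lookup∘tabulate (evenVal m ∘ toℕ)))

  R-lower-bound : ∀ m → k * k ^ m ≤ suc k * R k (k ^ m) + k
  R-lower-bound m = ≤-trans (#evenVal-lower m) (+-monoˡ-≤ k (*-monoʳ-≤ (suc k) #evenVal≤R))
    where
    #evenVal≤R : #evenVal m ≤ R k (k ^ m)
    #evenVal≤R = subst (_≤ R k (k ^ m)) (∣evenValSet∣≡#evenVal m)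
                       (kFree⇒∣A∣≤R k (evenValSet m) (evenValSet-kFree m))

m<k^m : ∀ {k} → 2 ≤ k → ∀ m → m < k ^ m
m<k^m 2≤k zero    = s≤s z≤n
m<k^m {k} 2≤k (suc m) = begin-strict
  suc m             <⟨ +-mono-≤ (≤-trans (s≤s z≤n) m<k^m′) m<k^m′ ⟩
  k ^ m + k ^ m     ≡⟨ cong (_+_ (k ^ m)) (+-identityʳ (k ^ m)) ⟨
  2 * k ^ m         ≤⟨ *-monoˡ-≤ (k ^ m) 2≤k ⟩
  k ^ suc m         ∎
  where
  open ≤-Reasoning
  m<k^m′ : m < k ^ m
  m<k^m′ = m<k^m 2≤k m

toℚᵘ-/ : ∀ a b → toℚᵘ ((+ a) / suc b) ℚᵘ.≃ mkℚᵘ (+ a) b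
toℚᵘ-/ a b = ℚ.toℚᵘ-fromℚᵘ (mkℚᵘ (+ a) b)

mkℚᵘ-≤ : ∀ {a b c d} → a * suc d ≤ c * suc b → mkℚᵘ (+ a) b ℚᵘ.≤ mkℚᵘ (+ c) d
mkℚᵘ-≤ {a} {b} {c} {d} ad≤cb =
  *≤* (subst₂ ℤ._≤_ (ℤ.pos-* a (suc d)) (ℤ.pos-* c (suc b)) (+≤+ ad≤cb))

/-≤-/ : ∀ {a b c d} → a * suc d ≤ c * suc b → (+ a) / suc b ℚ.≤ (+ c) / suc d
/-≤-/ {a} {b} {c} {d} ad≤cb = ℚ.toℚᵘ-cancel-≤ (begin
  toℚᵘ ((+ a) / suc b) ≃⟨ toℚᵘ-/ a b ⟩
  mkℚᵘ (+ a) b         ≤⟨ mkℚᵘ-≤ ad≤cb ⟩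
  mkℚᵘ (+ c) d         ≃⟨ toℚᵘ-/ c d ⟨
  toℚᵘ ((+ c) / suc d) ∎)
  where open ℚᵘ.≤-Reasoning

p≤p+ε : ∀ p ε → ℚ.Positive ε → p ℚ.≤ p ℚ.+ ε
p≤p+ε p ε ε>0 = ℚ.≤-trans (ℚ.≤-reflexive (sym (ℚ.+-identityʳ p)))
  (ℚ.+-monoʳ-≤ p (ℚ.nonNegative⁻¹ ε {{ℚ.pos⇒nonNeg ε {{ε>0}}}}))

p≤q+ε⇒p-ε≤q : ∀ {p q} ε → p ℚ.≤ q ℚ.+ ε → p ℚ.- ε ℚ.≤ q
p≤q+ε⇒p-ε≤q {p} {q} ε p≤q+ε =
  ℚ.≤-trans (ℚ.+-monoˡ-≤ (ℚ.- ε) p≤q+ε) (ℚ.≤-reflexive (begin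
    q ℚ.+ ε ℚ.- ε   ≡⟨ ℚ.+-assoc q ε (ℚ.- ε) ⟩
    q ℚ.+ (ε ℚ.- ε) ≡⟨ cong (q ℚ.+_) (ℚ.+-inverseʳ ε) ⟩
    q ℚ.+ ℚ.0ℚ      ≡⟨ ℚ.+-identityʳ q ⟩
    q               ∎))
  where open ≡-Reasoning

ratio-upper : ∀ {k r p} → suc k * r ≤ k * suc p → ∀ ε → ℚ.Positive ε →
              (+ r) / suc p ℚ.≤ (+ k) / suc k ℚ.+ ε
ratio-upper {k} {r} {p} bound ε ε>0 = ℚ.≤-trans
  (/-≤-/ {r} {p} {k} {k} (≤-trans (≤-reflexive (*-comm r (suc k))) bound))
  (p≤p+ε _ ε ε>0)

-- k/(k+1) ≤ r/n + (1+A)/D, cross-multiplied.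
cross-bound : ∀ {k r n D} A → k * n ≤ suc k * r + k → D ≤ n →
              k * (n * D) ≤ (r * D + suc A * n) * suc k
cross-bound {k} {r} {n} {D} A kn≤ D≤n = begin
  k * (n * D)                         ≡⟨ *-assoc k n D ⟨
  k * n * D                           ≤⟨ *-monoˡ-≤ D kn≤ ⟩
  (suc k * r + k) * D                 ≡⟨ *-distribʳ-+ D (suc k * r) k ⟩
  suc k * r * D + k * D               ≤⟨ +-monoʳ-≤ (suc k * r * D) kD≤ ⟩
  suc k * r * D + suc k * (suc A * n) ≡⟨ regroup k r D A n ⟩
  (r * D + suc A * n) * suc k         ∎
  where
  open ≤-Reasoning
  kD≤ : k * D ≤ suc k * (suc A * n)
  kD≤ = *-mono-≤ (n≤1+n k) (≤-trans D≤n (m≤m+n n (A * n)))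
  regroup : ∀ k r D A n → suc k * r * D + suc k * (suc A * n) ≡ (r * D + suc A * n) * suc k
  regroup = solve-∀

ratio-lower : ∀ {k r p} → k * suc p ≤ suc k * r + k →
              ∀ ε → ℚ.Positive ε → ℚ.↧ₙ ε ≤ suc p →
              (+ k) / suc k ℚ.- ε ℚ.≤ (+ r) / suc p
ratio-lower {k} {r} {p} kn≤ ε@(mkℚ +[1+ a ] d _) _ d≤n =
  p≤q+ε⇒p-ε≤q ε (ℚ.toℚᵘ-cancel-≤ (begin
    toℚᵘ ((+ k) / suc k)                                 ≃⟨ toℚᵘ-/ k k ⟩
    mkℚᵘ (+ k) k                                         ≤⟨ mkℚᵘ-≤ {k} {k} cross ⟩
    mkℚᵘ (+ (r * suc d + suc a * suc p)) (d + p * suc d)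
      ≡⟨ cong (λ z → mkℚᵘ z (d + p * suc d)) numerator ⟨
    mkℚᵘ (+ r) p ℚᵘ.+ toℚᵘ ε
      ≃⟨ ℚᵘ.+-congˡ (toℚᵘ ε) (toℚᵘ-/ r p) ⟨
    toℚᵘ ((+ r) / suc p) ℚᵘ.+ toℚᵘ ε
      ≃⟨ ℚ.toℚᵘ-homo-+ ((+ r) / suc p) ε ⟨
    toℚᵘ ((+ r) / suc p ℚ.+ ε)                           ∎))
  where
  open ℚᵘ.≤-Reasoning
  cross : k * (suc p * suc d) ≤ (r * suc d + suc a * suc p) * suc k
  cross = cross-bound {k} {r} {suc p} {suc d} a kn≤ d≤n
  numerator : + r ℤ.* +[1+ d ] ℤ.+ +[1+ a ] ℤ.* + suc p ≡ + (r * suc d + suc a * suc p)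
  numerator = sym (trans (ℤ.pos-+ (r * suc d) (suc a * suc p))
                         (cong₂ ℤ._+_ (ℤ.pos-* r (suc d)) (ℤ.pos-* (suc a) (suc p))))

proposition1 : (k : ℕ) → 2 ≤ k → LimsupEq (ratio k) ((+ k) / suc k)
proposition1 k@(suc j) 2≤k = upper , lower
  where
  open KAdicParity j using (R-lower-bound)
  upper : ∀ ε → ℚ.Positive ε → ∃[ N ] (∀ n → N ≤ n → ratio k n ℚ.≤ (+ k) / suc k ℚ.+ ε)
  upper ε ε>0 = 1 , λ where
    (suc p) _ → ratio-upper {k} {R k (suc p)} (R-upper-bound k (suc p) (s≤s z≤n)) ε ε>0
  -- n = k^(N + ↧ε) exceeds both N and the denominator of ε.
  lower : ∀ ε → ℚ.Positive ε → ∀ N → ∃[ n ] (N ≤ n × (+ k) / suc k ℚ.- ε ℚ.≤ ratio k n)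
  lower ε ε>0 N with k ^ (N + ℚ.↧ₙ ε) | m<k^m 2≤k (N + ℚ.↧ₙ ε) | R-lower-bound (N + ℚ.↧ₙ ε)
  ... | suc p | m<n | density =
    suc p , ≤-trans (m≤m+n N _) (<⇒≤ m<n) ,
    ratio-lower {k} {R k (suc p)} density ε ε>0 (≤-trans (m≤n+m _ N) (<⇒≤ m<n))
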